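{- Let $G$ be a graph, let $L, R$ be a partition of $V(G)$, let $u \in L$, and let $\Pi$ be the packing flow network for $u$. Then there is a one-to-one correspondence between integral flows on $\Pi$ and chordless $(3,L)$-admissible packings rooted at $u$ (the correspondence sending a packing to the flow that sends one unit along each of its paths).
   Context: All graphs are finite and simple; length of a path = number of edges. For $L\subseteq V(G)$, a path avoids $L$ if none of its inner vertices lies in $L$ (endpoints may). A path from $v$ to $x$ is $(r,L)$-admissible if it has length at most $r$ and avoids $L$. $\mathrm{Target}^r_L(v)$ is the set of $x \in L$, $x \ne v$, reachable from $v$ by an $(r,L)$-admissible path. An $(r,L)$-admissible packing rooted at $v$ is a collection of $(r,L)$-admissible paths $vP_1x_1,\dots,vP_kx_k$ such that the sequences $P_ix_i$ are pairwise vertex-disjoint and each $x_i \in \mathrm{Target}^r_L(v)$. Such a packing $H$ rooted at $v \in L$ is chordless if for every path $vwP \in H$ (with $P$ possibly empty) there is no edge between $v$ and any vertex of $P$. Packing flow network for $u \in L$: run a BFS from $u$ which does not expand vertices of $L$ other than $u$ (i.e. a vertex $x\neq u$ is discovered at step $i$ if the shortest path from $u$ to $x$ all of whose inner vertices lie in $R$ has length $i$), for three steps. For $i \in \{1,2,3\}$ let $S_i$ (resp. $T_i$) be the vertices of $R$ (resp. $L$) discovered at step $i$, with $T_0=\{u\}$, $S_0=\emptyset$, and the vertices of $R$ discovered at step 3 removed, i.e. $S_3=\emptyset$. $\Pi$ is the directed network whose arcs are the edges of $G$ directed from $T_0$ to $T_1\cup S_1$, from $S_1$ to $S_2\cup T_2$,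 and from $S_2$ to $T_2\cup T_3$. The source is $u$, the sinks are $T_1\cup T_2\cup T_3$; every arc and every vertex has capacity one, except $u$ which has infinite capacity. -}

module Defs where

open import Data.Nat using (ℕ; zero; suc; _+_; _≤_; _<_)
open import Data.Fin using (Fin)
open import Data.Fin.Properties using (_≟_)
open import Data.Bool using (Bool; true; false)
open import Data.List using (List; []; _∷_; _++_; length; map; filter; allFin)
open import Data.Nat.ListAction using (sum)
open import Data.List.Relation.Unary.All using (All)
open import Data.List.Relation.Unary.AllPairs using (AllPairs)
open import Data.List.Relation.Unary.Unique.Propositional using (Unique)
open import Data.List.Relation.Binary.Disjoint.Propositional using (Disjoint)
open import Data.Product using (Σ; ∃; _×_; _,_)
open import Data.Sum using (_⊎_)
open import Data.Unit using (⊤)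
open import Relation.Nullary using (¬_)
open import Relation.Nullary.Decidable using (_×-dec_)
open import Relation.Binary.PropositionalEquality using (_≡_; _≢_)

record Graph (n : ℕ) : Set where
  field
    adj    : Fin n → Fin n → Bool
    sym    : ∀ a b → adj a b ≡ adj b a
    irrefl : ∀ a → adj a a ≡ false

module _ {n : ℕ} (G : Graph n) (L : Fin n → Bool) where
  -- The partition (L , R) of V(G) is given by the Boolean predicate L :
  -- x ∈ L iff L x ≡ true, and x ∈ R iff L x ≡ false.
  open Graph G

  Chain : List (Fin n) → Set
  Chain []           = ⊤
  Chain (a ∷ [])     = ⊤
  Chain (a ∷ b ∷ vs) = adj a b ≡ true × Chain (b ∷ vs)

  IsPath : List (Fin n) → Set
  IsPath vs = Chain vs × Unique vs

  -- A rooted path  v P x  is represented by the pair (P , x).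
  RootedPath : Set
  RootedPath = List (Fin n) × Fin n

  tailVs : RootedPath → List (Fin n)
  tailVs (P , x) = P ++ (x ∷ [])

  pathVs : Fin n → RootedPath → List (Fin n)
  pathVs v p = v ∷ tailVs p

  Admissible : ℕ → Fin n → RootedPath → Set
  Admissible r v (P , x) =
    IsPath (pathVs v (P , x))
    × suc (length P) ≤ r                 -- length (number of edges) ≤ r
    × All (λ y → L y ≡ false) P
    × L x ≡ true × x ≢ v

  -- (r,L)-admissible packing rooted at v (a collection, given as a list)
  Packing : ℕ → Fin n → List RootedPath → Set
  Packing r v H =
    All (Admissible r v) H
    × AllPairs (λ p q → Disjoint (tailVs p) (tailVs q)) H

  NoChord : Fin n → List (Fin n) → Set
  NoChord v []       = ⊤
  NoChord v (w ∷ ps) = All (λ y → adj v y ≡ false) ps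

  ChordlessPacking : ℕ → Fin n → List RootedPath → Set
  ChordlessPacking r v H = Packing r v H × All (λ p → NoChord v (tailVs p)) H

  module _ (u : Fin n) where
    -- RW k x : there is a walk u = w₀ … w_k = x whose inner vertices lie in R
    RW : ℕ → Fin n → Set
    RW zero    x = x ≡ u
    RW (suc k) x = Σ (Fin n) λ y → RW k y × adj y x ≡ true × (k ≡ 0 ⊎ L y ≡ false)

    -- x ≠ u is discovered at step i of the BFS
    Disc : ℕ → Fin n → Set
    Disc i x = x ≢ u × RW i x × (∀ j → j < i → ¬ RW j x)

    S : ℕ → Fin n → Set
    S i x = Disc i x × L x ≡ false

    T : ℕ → Fin n → Set
    T i x = Disc i x × L x ≡ true

    -- arcs of Π (S₃ = ∅, T₀ = {u})
    Arc : Fin n → Fin n → Set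
    Arc a b = adj a b ≡ true ×
      ( (a ≡ u × (T 1 b ⊎ S 1 b))
      ⊎ (S 1 a × (S 2 b ⊎ T 2 b))
      ⊎ (S 2 a × (T 2 b ⊎ T 3 b)) )

    inflow : (Fin n → Fin n → ℕ) → Fin n → ℕ
    inflow f v = sum (map (λ a → f a v) (allFin n))

    outflow : (Fin n → Fin n → ℕ) → Fin n → ℕ
    outflow f v = sum (map (λ b → f v b) (allFin n))

    -- an integral flow on Π (source u, sinks T₁ ∪ T₂ ∪ T₃, all arcs and
    -- all vertices other than u of capacity one)
    IntegralFlow : (Fin n → Fin n → ℕ) → Set
    IntegralFlow f =
      (∀ a b → 0 < f a b → Arc a b)
      × (∀ a b → f a b ≤ 1)
      × (∀ v → v ≢ u → inflow f v ≤ 1)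
      × (∀ v → v ≢ u → outflow f v ≤ 1)
      × (∀ v → S 1 v ⊎ S 2 v → inflow f v ≡ outflow f v)

  arcsOf : List (Fin n) → List (Fin n × Fin n)
  arcsOf []           = []
  arcsOf (a ∷ [])     = []
  arcsOf (a ∷ b ∷ vs) = (a , b) ∷ arcsOf (b ∷ vs)

  countArc : Fin n → Fin n → List (Fin n × Fin n) → ℕ
  countArc a b es = length (filter (λ e → (Data.Product.proj₁ e ≟ a) ×-dec (Data.Product.proj₂ e ≟ b)) es)

  flowOf : Fin n → List RootedPath → Fin n → Fin n → ℕ
  flowOf v H a b = sum (map (λ p → countArc a b (arcsOf (pathVs v p))) H)

-- A chordless (3,L)-admissible path from u is u x, u s x or u s t x with s ∈ S₁, t ∈ S₂:
-- chordlessness is exactly what keeps t and the endpoint out of the first BFS layer, so these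
-- paths are the source–sink paths of Π.  Disjoint tails then make the unit flow along a packing
-- respect all capacities and conserve flow at R-vertices.  Conversely, unit vertex capacities
-- give every vertex other than u at most one flow predecessor and successor, so following the
-- flow from each out-neighbour of u traces source–sink paths, disjoint because tracing back
-- from a common vertex leads to a common start; and a packing is determined by its flow, each
-- path being recovered by following the flow from its first arc.

module Submission where

open import Defs
open import Data.Bool using (Bool; true; false)
import Data.Bool.Properties as Bool
open import Data.Empty using (⊥; ⊥-elim)
open import Data.Fin using (Fin)
import Data.Fin.Properties as Fin
open import Data.List using (List; []; _∷_; _++_; length; map; filter; allFin)
open import Data.List.Properties using (filter-none; filter-accept; filter-reject; ∷ʳ-injective)
open import Data.List.Membership.Propositional using (_∈_; _∉_; find; lose)
open import Data.List.Membership.Propositional.Properties using (∈-allFin; ∈-filter⁺; ∈-++⁻; ∈-++⁺ʳ)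
open import Data.List.Membership.Propositional.Properties.WithK using (unique∧set⇒bag)
import Data.List.Membership.DecPropositional as DecMembership
open import Data.List.Relation.Binary.BagAndSetEquality using (∼bag⇒↭)
open import Data.List.Relation.Binary.Disjoint.Propositional using (Disjoint)
open import Data.List.Relation.Binary.Permutation.Propositional using (_↭_)
open import Data.List.Relation.Unary.All as All using (All; []; _∷_)
open import Data.List.Relation.Unary.All.Properties using (All¬⇒¬Any; all-filter)
open import Data.List.Relation.Unary.AllPairs as AllPairs using (AllPairs; []; _∷_)
open import Data.List.Relation.Unary.Any as Any using (Any; here; there)
open import Data.List.Relation.Unary.Unique.Propositional using (Unique)
import Data.List.Relation.Unary.Unique.Propositional.Properties as Unique
open import Data.Nat using (ℕ; zero; suc; _+_; _≤_; _<_; z≤n; s≤s)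
open import Data.Nat.ListAction using (sum)
import Data.Nat.Properties as ℕ
open import Data.Product using (Σ; ∃; _×_; _,_; proj₁; proj₂; uncurry)
open import Data.Product.Properties using (≡-dec)
open import Data.Sum using (_⊎_; inj₁; inj₂; [_,_])
open import Data.Unit using (tt)
open import Function using (_∘_; mk⇔)
open import Relation.Nullary using (¬_; Dec; yes; no; contradiction)
open import Relation.Nullary.Decidable using (_×-dec_)
open import Relation.Binary.PropositionalEquality
  using (_≡_; _≢_; refl; sym; trans; cong; cong₂; subst; ≢-sym; module ≡-Reasoning)

≡1⇒≢0 : ∀ {k} → k ≡ 1 → k ≢ 0
≡1⇒≢0 refl ()

module _ {A : Set} (g : A → ℕ) where

  sum-map-≡0 : ∀ {xs} → (∀ {a} → a ∈ xs → g a ≡ 0) → sum (map g xs) ≡ 0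
  sum-map-≡0 {[]}     _   = refl
  sum-map-≡0 {_ ∷ _} g≡0 = cong₂ _+_ (g≡0 (here refl)) (sum-map-≡0 (λ a∈ → g≡0 (there a∈)))

  sum-map-≡ : ∀ {xs c} → Unique xs → c ∈ xs → (∀ {a} → a ∈ xs → a ≢ c → g a ≡ 0) →
              sum (map g xs) ≡ g c
  sum-map-≡ (x∉xs ∷ _) (here refl) g≡0 =
    trans (cong (_ +_) (sum-map-≡0 λ a∈ → g≡0 (there a∈) λ { refl → All¬⇒¬Any x∉xs a∈ }))
          (ℕ.+-identityʳ _)
  sum-map-≡ (x∉xs ∷ xs!) (there c∈) g≡0 =
    cong₂ _+_ (g≡0 (here refl) λ { refl → All¬⇒¬Any x∉xs c∈ })
              (sum-map-≡ xs! c∈ (λ a∈ → g≡0 (there a∈)))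

  sum-map-≤ : ∀ {xs c} → c ∈ xs → g c ≤ sum (map g xs)
  sum-map-≤ (here refl) = ℕ.m≤m+n _ _
  sum-map-≤ (there c∈)  = ℕ.≤-trans (sum-map-≤ c∈) (ℕ.m≤n+m _ _)

  sum-map-≤₂ : ∀ {xs c c′} → c ∈ xs → c′ ∈ xs → c ≢ c′ → g c + g c′ ≤ sum (map g xs)
  sum-map-≤₂ (here refl) (here refl)  c≢c′ = contradiction refl c≢c′
  sum-map-≤₂ (here refl) (there c′∈) _    = ℕ.+-monoʳ-≤ _ (sum-map-≤ c′∈)
  sum-map-≤₂ {x ∷ xs} {c} (there c∈) (here refl) _ =
    subst (_≤ g x + sum (map g xs)) (ℕ.+-comm (g x) (g c)) (ℕ.+-monoʳ-≤ (g x) (sum-map-≤ c∈))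
  sum-map-≤₂ (there c∈) (there c′∈) c≢c′ = ℕ.≤-trans (sum-map-≤₂ c∈ c′∈ c≢c′) (ℕ.m≤n+m _ _)

  sum-map-≢0 : ∀ xs → sum (map g xs) ≢ 0 → ∃ λ a → a ∈ xs × g a ≢ 0
  sum-map-≢0 []       sum≢0 = contradiction refl sum≢0
  sum-map-≢0 (x ∷ xs) sum≢0 with g x ℕ.≟ 0
  ... | no  gx≢0 = x , here refl , gx≢0
  ... | yes gx≡0 =
    let a , a∈ , ga≢0 = sum-map-≢0 xs (sum≢0 ∘ trans (cong (_+ sum (map g xs)) gx≡0))
    in a , there a∈ , ga≢0

module _ {n : ℕ} where

  total : (Fin n → ℕ) → ℕ
  total g = sum (map g (allFin n))

  module _ {g : Fin n → ℕ} where

    total-≡0 : (∀ a → g a ≡ 0) → total g ≡ 0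
    total-≡0 g≡0 = sum-map-≡0 g {allFin n} (λ {a} _ → g≡0 a)

    total-≡ : ∀ {c} → (∀ a → g a ≢ 0 → a ≡ c) → total g ≡ g c
    total-≡ {c} supp = sum-map-≡ g (Unique.allFin⁺ n) (∈-allFin c) outside
      where
      outside : ∀ {a} → a ∈ allFin n → a ≢ c → g a ≡ 0
      outside {a} _ a≢c with g a ℕ.≟ 0
      ... | yes ga≡0 = ga≡0
      ... | no  ga≢0 = contradiction (supp a ga≢0) a≢c

    total-≢0 : total g ≢ 0 → ∃ λ a → g a ≢ 0
    total-≢0 total≢0 = let a , _ , ga≢0 = sum-map-≢0 g (allFin n) total≢0 in a , ga≢0

    ≢0⇒total≢0 : ∀ {a} → g a ≢ 0 → total g ≢ 0
    ≢0⇒total≢0 {a} ga≢0 total≡0 =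
      ga≢0 (ℕ.n≤0⇒n≡0 (subst (g a ≤_) total≡0 (sum-map-≤ g (∈-allFin a))))

    total-≤1 : (∀ a → g a ≤ 1) → (∀ a a′ → g a ≢ 0 → g a′ ≢ 0 → a ≡ a′) → total g ≤ 1
    total-≤1 g≤1 supp with total g ℕ.≟ 0
    ... | yes total≡0 = subst (_≤ 1) (sym total≡0) z≤n
    ... | no  total≢0 =
      let c , gc≢0 = total-≢0 total≢0
      in subst (_≤ 1) (sym (total-≡ λ a ga≢0 → supp a c ga≢0 gc≢0)) (g≤1 c)

    total-≤1⇒≡ : ∀ {a a′} → total g ≤ 1 → g a ≡ 1 → g a′ ≡ 1 → a ≡ a′
    total-≤1⇒≡ {a} {a′} total≤1 ga≡1 ga′≡1 with a Fin.≟ a′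
    ... | yes a≡a′ = a≡a′
    ... | no  a≢a′ = contradiction
      (ℕ.≤-trans (subst (_≤ total g) (cong₂ _+_ ga≡1 ga′≡1)
                        (sum-map-≤₂ g (∈-allFin a) (∈-allFin a′) a≢a′))
                 total≤1)
      λ { (s≤s ()) }

module _ {n : ℕ} (G : Graph n) (L : Fin n → Bool) where
  open Graph G using (adj)

  arcs : List (Fin n) → List (Fin n × Fin n)
  arcs = arcsOf G L

  private
    _≟ᵃ_ : (e e′ : Fin n × Fin n) → Dec (e ≡ e′)
    _≟ᵃ_ = ≡-dec Fin._≟_ Fin._≟_

    isArc? : ∀ a b (e : Fin n × Fin n) → Dec (proj₁ e ≡ a × proj₂ e ≡ b)
    isArc? a b e = (proj₁ e Fin.≟ a) ×-dec (proj₂ e Fin.≟ b)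

  open DecMembership _≟ᵃ_ using () renaming (_∈?_ to _∈ᵃ?_)
  open DecMembership (Fin._≟_ {n}) using (_∈?_)

  countArc-∉ : ∀ {a b es} → (a , b) ∉ es → countArc G L a b es ≡ 0
  countArc-∉ {a} {b} ab∉ =
    cong length (filter-none (isArc? a b) (All.tabulate λ { e∈ (refl , refl) → ab∉ e∈ }))

  countArc-∈ : ∀ {a b es} → Unique es → (a , b) ∈ es → countArc G L a b es ≡ 1
  countArc-∈ {a} {b} (e∉ ∷ _) (here refl) =
    trans (cong length (filter-accept (isArc? a b) (refl , refl)))
          (cong suc (countArc-∉ (All¬⇒¬Any e∉)))
  countArc-∈ {a} {b} {e ∷ es} (e∉ ∷ es!) (there ab∈) =
    trans (cong length (filter-reject (isArc? a b) {e} {es} λ { (refl , refl) → All¬⇒¬Any e∉ ab∈ }))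
          (countArc-∈ es! ab∈)

  countArc-≢0 : ∀ {a b es} → countArc G L a b es ≢ 0 → (a , b) ∈ es
  countArc-≢0 {a} {b} {es} count≢0 with (a , b) ∈ᵃ? es
  ... | yes ab∈ = ab∈
  ... | no  ab∉ = contradiction (countArc-∉ ab∉) count≢0

  arcs-source∈ : ∀ {vs a b} → (a , b) ∈ arcs vs → a ∈ vs
  arcs-source∈ {_ ∷ _ ∷ _}  (here refl) = here refl
  arcs-source∈ {_ ∷ _ ∷ _}  (there ab∈) = there (arcs-source∈ ab∈)

  arcs-target∈ : ∀ {v vs a b} → (a , b) ∈ arcs (v ∷ vs) → b ∈ vs
  arcs-target∈ {vs = _ ∷ _} (here refl) = here refl
  arcs-target∈ {vs = _ ∷ _} (there ab∈) = there (arcs-target∈ ab∈)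

  arcs-∷ : ∀ {v vs e} → e ∈ arcs vs → e ∈ arcs (v ∷ vs)
  arcs-∷ {vs = _ ∷ _} e∈ = there e∈

  arcs-unique : ∀ {vs} → Unique vs → Unique (arcs vs)
  arcs-unique {[]}        _            = []
  arcs-unique {_ ∷ []}    _            = []
  arcs-unique {_ ∷ _ ∷ _} (v∉ ∷ vs!) =
    All.tabulate (λ { e∈ refl → All¬⇒¬Any v∉ (arcs-source∈ e∈) }) ∷ arcs-unique vs!

  arcs-pred-unique : ∀ {vs a a′ b} → Unique vs → (a , b) ∈ arcs vs → (a′ , b) ∈ arcs vs → a ≡ a′
  arcs-pred-unique {_ ∷ _ ∷ _} _            (here refl) (here refl)  = refl
  arcs-pred-unique {_ ∷ _ ∷ _} (_ ∷ w∉ ∷ _) (here refl) (there ab∈) =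
    contradiction (arcs-target∈ ab∈) (All¬⇒¬Any w∉)
  arcs-pred-unique {_ ∷ _ ∷ _} (_ ∷ w∉ ∷ _) (there ab∈) (here refl) =
    contradiction (arcs-target∈ ab∈) (All¬⇒¬Any w∉)
  arcs-pred-unique {_ ∷ _ ∷ _} (_ ∷ vs!)    (there ab∈) (there a′b∈) = arcs-pred-unique vs! ab∈ a′b∈

  arcs-succ-unique : ∀ {vs a b b′} → Unique vs → (a , b) ∈ arcs vs → (a , b′) ∈ arcs vs → b ≡ b′
  arcs-succ-unique {_ ∷ _ ∷ _} _        (here refl) (here refl)  = refl
  arcs-succ-unique {_ ∷ _ ∷ _} (v∉ ∷ _) (here refl) (there ab∈) =
    contradiction (arcs-source∈ ab∈) (All¬⇒¬Any v∉)
  arcs-succ-unique {_ ∷ _ ∷ _} (v∉ ∷ _) (there ab∈) (here refl) =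
    contradiction (arcs-source∈ ab∈) (All¬⇒¬Any v∉)
  arcs-succ-unique {_ ∷ _ ∷ _} (_ ∷ vs!) (there ab∈) (there ab′∈) = arcs-succ-unique vs! ab∈ ab′∈

  arcs-pred : ∀ {v vs b} → b ∈ vs → ∃ λ a → (a , b) ∈ arcs (v ∷ vs)
  arcs-pred {v}            (here refl) = v , here refl
  arcs-pred {vs = w ∷ _} (there b∈)  = let a , ab∈ = arcs-pred {w} b∈ in a , there ab∈

  arcs-succ : ∀ {P x v} → v ∈ P → ∃ λ b → (v , b) ∈ arcs (P ++ x ∷ [])
  arcs-succ {_ ∷ []}    {x} (here refl) = x , here refl
  arcs-succ {_ ∷ []}        (there ())
  arcs-succ {_ ∷ w ∷ _}     (here refl) = w , here refl
  arcs-succ {_ ∷ w ∷ P} {x} (there v∈)  = let b , vb∈ = arcs-succ {w ∷ P} {x} v∈ in b , there vb∈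

  ArcsFollow : List (Fin n) → List (Fin n) → Set
  ArcsFollow xs ys = ∀ {a b} → (a , b) ∈ arcs xs → a ∈ ys → (a , b) ∈ arcs ys

  -- Walking from c, the two sequences keep taking the same arc, so they never diverge.
  arcs-agree⇒≡ : ∀ {c xs ys} → Unique (c ∷ xs) → Unique (c ∷ ys) →
                 ArcsFollow (c ∷ xs) (c ∷ ys) → ArcsFollow (c ∷ ys) (c ∷ xs) → xs ≡ ys
  arcs-agree⇒≡ {xs = []}    {[]}    _ _ _ _ = refl
  arcs-agree⇒≡ {xs = []}    {_ ∷ _} _ _ _ ys→xs with ys→xs (here refl) (here refl)
  ... | ()
  arcs-agree⇒≡ {xs = _ ∷ _} {[]}    _ _ xs→ys _ with xs→ys (here refl) (here refl)
  ... | ()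
  arcs-agree⇒≡ {c} {x ∷ xs} {y ∷ ys} (c∉xs ∷ xs!) (c∉ys ∷ ys!) xs→ys ys→xs
    with xs→ys (here refl) (here refl)
  ... | there cx∈ = contradiction (arcs-source∈ cx∈) (All¬⇒¬Any c∉ys)
  ... | here refl = cong (x ∷_) (arcs-agree⇒≡ xs! ys! (drop c∉xs xs→ys) (drop c∉ys ys→xs))
    where
    drop : ∀ {zs ws} → All (c ≢_) (x ∷ zs) →
           ArcsFollow (c ∷ x ∷ zs) (c ∷ x ∷ ws) → ArcsFollow (x ∷ zs) (x ∷ ws)
    drop c∉zs follow ab∈ a∈ with follow (there ab∈) (there a∈)
    ... | here refl = contradiction (arcs-source∈ ab∈) (All¬⇒¬Any c∉zs)
    ... | there ab∈′ = ab∈′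

  DisjointTails : RootedPath G L → RootedPath G L → Set
  DisjointTails p q = Disjoint (tailVs G L p) (tailVs G L q)

  tailVs-injective : ∀ {p q} → tailVs G L p ≡ tailVs G L q → p ≡ q
  tailVs-injective {P , _} {Q , _} eq with ∷ʳ-injective P Q eq
  ... | refl , refl = refl

  DisjointTails⇒≢ : ∀ {p q} → DisjointTails p q → p ≢ q
  DisjointTails⇒≢ {P , _} dj refl = dj (∈-++⁺ʳ P (here refl) , ∈-++⁺ʳ P (here refl))

  tails-meet⇒≡ : ∀ {H p q z} → AllPairs DisjointTails H → p ∈ H → q ∈ H →
                 z ∈ tailVs G L p → z ∈ tailVs G L q → p ≡ q
  tails-meet⇒≡ _         (here refl) (here refl) _   _   = refl
  tails-meet⇒≡ (dj ∷ _)  (here refl) (there q∈)  z∈p z∈q = contradiction (z∈p , z∈q) (All.lookup dj q∈)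
  tails-meet⇒≡ (dj ∷ _)  (there p∈)  (here refl) z∈p z∈q = contradiction (z∈q , z∈p) (All.lookup dj p∈)
  tails-meet⇒≡ (_ ∷ djs) (there p∈)  (there q∈)  z∈p z∈q = tails-meet⇒≡ djs p∈ q∈ z∈p z∈q

  module _ (u : Fin n) where

    RW₁ RW₂ S₁ S₂ T₁ T₂ T₃ : Fin n → Set
    RW₁ = RW G L u 1
    RW₂ = RW G L u 2
    S₁  = S G L u 1
    S₂  = S G L u 2
    T₁  = T G L u 1
    T₂  = T G L u 2
    T₃  = T G L u 3

    ΠArc : Fin n → Fin n → Set
    ΠArc = Arc G L u

    Distant : Fin n → Set
    Distant x = x ≢ u × ¬ RW₁ x

    adj⇒RW₁ : ∀ {x} → adj u x ≡ true → RW₁ x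
    adj⇒RW₁ e = u , refl , e , inj₁ refl

    RW₁⇒adj : ∀ {x} → RW₁ x → adj u x ≡ true
    RW₁⇒adj (_ , refl , e , _) = e

    ¬RW₁⇒nonadj : ∀ {x} → ¬ RW₁ x → adj u x ≡ false
    ¬RW₁⇒nonadj ¬rw = Bool.¬-not (¬rw ∘ adj⇒RW₁)

    nonadj⇒¬RW₁ : ∀ {x} → adj u x ≡ false → ¬ RW₁ x
    nonadj⇒¬RW₁ nonadj rw = Bool.not-¬ nonadj (RW₁⇒adj rw)

    RW-step : ∀ {k x y} → RW G L u k y → adj y x ≡ true → L y ≡ false → RW G L u (suc k) x
    RW-step rw e Ly = _ , rw , e , inj₂ Ly

    RW₂? : ∀ x → Dec (RW₂ x)
    RW₂? x with Fin.any? (λ y → adj u y Bool.≟ true ×-dec adj y x Bool.≟ true ×-dec L y Bool.≟ false)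
    ... | yes (_ , e₁ , e₂ , Ly) = yes (RW-step (adj⇒RW₁ e₁) e₂ Ly)
    ... | no  ∄y = no λ { (_ , _ , _ , inj₁ ())
                        ; (y , rw , e , inj₂ Ly) → ∄y (y , RW₁⇒adj rw , e , Ly) }

    disc₁ : ∀ {x} → x ≢ u → adj u x ≡ true → Disc G L u 1 x
    disc₁ x≢u e = x≢u , adj⇒RW₁ e , λ { zero _ → x≢u ; (suc _) (s≤s ()) }

    disc₂ : ∀ {x} → x ≢ u → RW₂ x → adj u x ≡ false → Disc G L u 2 x
    disc₂ x≢u rw nonadj =
      x≢u , rw , λ { zero _ → x≢u ; 1 _ → nonadj⇒¬RW₁ nonadj ; (suc (suc _)) (s≤s (s≤s ())) }

    disc₃ : ∀ {x} → x ≢ u → RW G L u 3 x → adj u x ≡ false → ¬ RW₂ x → Disc G L u 3 x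
    disc₃ x≢u rw nonadj ¬rw₂ =
      x≢u , rw , λ { zero _ → x≢u ; 1 _ → nonadj⇒¬RW₁ nonadj ; 2 _ → ¬rw₂
                   ; (suc (suc (suc _))) (s≤s (s≤s (s≤s ()))) }

    Disc⇒Distant : ∀ {i x} → 1 < i → Disc G L u i x → Distant x
    Disc⇒Distant 1<i (x≢u , _ , earlier) = x≢u , earlier 1 1<i

    S₂⇒Distant : ∀ {x} → S₂ x → Distant x
    S₂⇒Distant (d , _) = Disc⇒Distant (s≤s (s≤s z≤n)) d

    T₂₃⇒Distant : ∀ {x} → T₂ x ⊎ T₃ x → Distant x
    T₂₃⇒Distant (inj₁ (d , _)) = Disc⇒Distant (s≤s (s≤s z≤n)) d
    T₂₃⇒Distant (inj₂ (d , _)) = Disc⇒Distant (s≤s (s≤s z≤n)) d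

    T₂₃-L : ∀ {x} → T₂ x ⊎ T₃ x → L x ≡ true
    T₂₃-L = [ proj₂ , proj₂ ]

    S-≢u : ∀ {i x} → S G L u i x → x ≢ u
    S-≢u ((x≢u , _) , _) = x≢u

    S-R : ∀ {i x} → S G L u i x → L x ≡ false
    S-R = proj₂

    R≢L : ∀ {a b} → L a ≡ false → L b ≡ true → a ≢ b
    R≢L La Lb refl = contradiction (trans (sym La) Lb) λ ()

    S∩T : ∀ {i j x} → S G L u i x → T G L u j x → ⊥
    S∩T (_ , Lx) (_ , Lx′) = R≢L Lx Lx′ refl

    S₁∩S₂ : ∀ {x} → S₁ x → S₂ x → ⊥
    S₁∩S₂ ((_ , rw , _) , _) ((_ , _ , earlier) , _) = earlier 1 (s≤s (s≤s z≤n)) rw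

    ΠArc-source : ∀ {a b} → ΠArc a b → a ≡ u ⊎ S₁ a ⊎ S₂ a
    ΠArc-source (_ , inj₁ (a≡u , _))        = inj₁ a≡u
    ΠArc-source (_ , inj₂ (inj₁ (s₁ , _))) = inj₂ (inj₁ s₁)
    ΠArc-source (_ , inj₂ (inj₂ (s₂ , _))) = inj₂ (inj₂ s₂)

    ΠArc-from-u : ∀ {b} → ΠArc u b → T₁ b ⊎ S₁ b
    ΠArc-from-u (_ , inj₁ (_ , b∈))         = b∈
    ΠArc-from-u (_ , inj₂ (inj₁ (s₁ , _))) = contradiction refl (S-≢u s₁)
    ΠArc-from-u (_ , inj₂ (inj₂ (s₂ , _))) = contradiction refl (S-≢u s₂)

    ΠArc-from-S₁ : ∀ {a b} → S₁ a → ΠArc a b → S₂ b ⊎ T₂ b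
    ΠArc-from-S₁ s₁ (_ , inj₁ (refl , _))        = contradiction refl (S-≢u s₁)
    ΠArc-from-S₁ _  (_ , inj₂ (inj₁ (_ , b∈)))  = b∈
    ΠArc-from-S₁ s₁ (_ , inj₂ (inj₂ (s₂ , _)))  = ⊥-elim (S₁∩S₂ s₁ s₂)

    ΠArc-from-S₂ : ∀ {a b} → S₂ a → ΠArc a b → T₂ b ⊎ T₃ b
    ΠArc-from-S₂ s₂ (_ , inj₁ (refl , _))        = contradiction refl (S-≢u s₂)
    ΠArc-from-S₂ s₂ (_ , inj₂ (inj₁ (s₁ , _)))  = ⊥-elim (S₁∩S₂ s₁ s₂)
    ΠArc-from-S₂ _  (_ , inj₂ (inj₂ (_ , b∈)))  = b∈

    ΠArc-into-S₁ : ∀ {a b} → S₁ b → ΠArc a b → a ≡ u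
    ΠArc-into-S₁ _  (_ , inj₁ (a≡u , _))                = a≡u
    ΠArc-into-S₁ s₁ (_ , inj₂ (inj₁ (_ , inj₁ s₂)))    = ⊥-elim (S₁∩S₂ s₁ s₂)
    ΠArc-into-S₁ s₁ (_ , inj₂ (inj₁ (_ , inj₂ t₂)))    = ⊥-elim (S∩T s₁ t₂)
    ΠArc-into-S₁ s₁ (_ , inj₂ (inj₂ (_ , inj₁ t₂)))    = ⊥-elim (S∩T s₁ t₂)
    ΠArc-into-S₁ s₁ (_ , inj₂ (inj₂ (_ , inj₂ t₃)))    = ⊥-elim (S∩T s₁ t₃)

    ΠArc-into-S₂ : ∀ {a b} → S₂ b → ΠArc a b → S₁ a
    ΠArc-into-S₂ s₂ (_ , inj₁ (_ , inj₁ t₁))            = ⊥-elim (S∩T s₂ t₁)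
    ΠArc-into-S₂ s₂ (_ , inj₁ (_ , inj₂ s₁))            = ⊥-elim (S₁∩S₂ s₁ s₂)
    ΠArc-into-S₂ _  (_ , inj₂ (inj₁ (s₁ , _)))         = s₁
    ΠArc-into-S₂ s₂ (_ , inj₂ (inj₂ (_ , inj₁ t₂)))    = ⊥-elim (S∩T s₂ t₂)
    ΠArc-into-S₂ s₂ (_ , inj₂ (inj₂ (_ , inj₂ t₃)))    = ⊥-elim (S∩T s₂ t₃)

    -- The source–sink paths of Π; these are exactly the chordless (3,L)-admissible paths from u.
    data ΠPath : RootedPath G L → Set where
      direct   : ∀ {x} → T₁ x → ΠPath ([] , x)
      via-S₁   : ∀ {s x} → S₁ s → T₂ x → adj s x ≡ true → ΠPath (s ∷ [] , x)
      via-S₁S₂ : ∀ {s t x} → S₁ s → S₂ t → T₂ x ⊎ T₃ x → adj s t ≡ true → adj t x ≡ true →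
                 ΠPath (s ∷ t ∷ [] , x)

    ΠPath-arcs : ∀ {p} → ΠPath p → All (uncurry ΠArc) (arcs (pathVs G L u p))
    ΠPath-arcs (direct t₁@((_ , rw , _) , _)) =
      (RW₁⇒adj rw , inj₁ (refl , inj₁ t₁)) ∷ []
    ΠPath-arcs (via-S₁ s₁@((_ , rw , _) , _) t₂ e) =
      (RW₁⇒adj rw , inj₁ (refl , inj₂ s₁)) ∷ (e , inj₂ (inj₁ (s₁ , inj₂ t₂))) ∷ []
    ΠPath-arcs (via-S₁S₂ s₁@((_ , rw , _) , _) s₂ x∈ e₂ e₃) =
      (RW₁⇒adj rw , inj₁ (refl , inj₂ s₁)) ∷ (e₂ , inj₂ (inj₁ (s₁ , inj₁ s₂)))
        ∷ (e₃ , inj₂ (inj₂ (s₂ , x∈))) ∷ []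

    chordless⇒ΠPath : ∀ {p} → Admissible G L 3 u p → NoChord G L u (tailVs G L p) → ΠPath p
    chordless⇒ΠPath {[] , x} (((e , _) , _) , _ , [] , Lx , x≢u) _ = direct (disc₁ x≢u e , Lx)
    chordless⇒ΠPath {s ∷ [] , x}
      (((e₁ , e₂ , _) , ((u≢s ∷ _) ∷ _)) , _ , (Ls ∷ []) , Lx , x≢u) (x≁u ∷ []) =
      via-S₁ (disc₁ (≢-sym u≢s) e₁ , Ls) (disc₂ x≢u (RW-step (adj⇒RW₁ e₁) e₂ Ls) x≁u , Lx) e₂
    chordless⇒ΠPath {s ∷ t ∷ [] , x}
      (((e₁ , e₂ , e₃ , _) , ((u≢s ∷ u≢t ∷ _) ∷ _)) , _ , (Ls ∷ Lt ∷ []) , Lx , x≢u) (t≁u ∷ x≁u ∷ []) =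
      via-S₁S₂ (disc₁ (≢-sym u≢s) e₁ , Ls) (disc₂ (≢-sym u≢t) rw₂t t≁u , Lt) x∈T₂₃ e₂ e₃
      where
      rw₂t : RW₂ t
      rw₂t = RW-step (adj⇒RW₁ e₁) e₂ Ls
      x∈T₂₃ : T₂ x ⊎ T₃ x
      x∈T₂₃ with RW₂? x
      ... | yes rw₂x = inj₁ (disc₂ x≢u rw₂x x≁u , Lx)
      ... | no ¬rw₂x = inj₂ (disc₃ x≢u (RW-step rw₂t e₃ Lt) x≁u ¬rw₂x , Lx)
    chordless⇒ΠPath {_ ∷ _ ∷ _ ∷ _ , _} (_ , s≤s (s≤s (s≤s ())) , _) _

    ΠPath⇒admissible : ∀ {p} → ΠPath p → Admissible G L 3 u p
    ΠPath⇒admissible (direct ((x≢u , rw , _) , Lx)) =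
      ((RW₁⇒adj rw , tt) , (≢-sym x≢u ∷ []) ∷ [] ∷ []) , s≤s z≤n , [] , Lx , x≢u
    ΠPath⇒admissible (via-S₁ ((s≢u , rw , _) , Ls) ((x≢u , _) , Lx) e) =
      ((RW₁⇒adj rw , e , tt) ,
       (≢-sym s≢u ∷ ≢-sym x≢u ∷ []) ∷ (R≢L Ls Lx ∷ []) ∷ [] ∷ []) ,
      s≤s (s≤s z≤n) , Ls ∷ [] , Lx , x≢u
    ΠPath⇒admissible (via-S₁S₂ ((s≢u , rw , _) , Ls) s₂@(_ , Lt) x∈ e₂ e₃) =
      let t≢u , ¬rwt = S₂⇒Distant s₂
          x≢u , _ = T₂₃⇒Distant x∈
          Lx = T₂₃-L x∈
      in ((RW₁⇒adj rw , e₂ , e₃ , tt) ,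
          (≢-sym s≢u ∷ ≢-sym t≢u ∷ ≢-sym x≢u ∷ []) ∷ ((λ { refl → ¬rwt rw }) ∷ R≢L Ls Lx ∷ [])
            ∷ (R≢L Lt Lx ∷ []) ∷ [] ∷ []) ,
         s≤s (s≤s (s≤s z≤n)) , Ls ∷ Lt ∷ [] , Lx , x≢u

    ΠPath⇒chordless : ∀ {p} → ΠPath p → NoChord G L u (tailVs G L p)
    ΠPath⇒chordless (direct _)               = []
    ΠPath⇒chordless (via-S₁ _ t₂ _)          = ¬RW₁⇒nonadj (proj₂ (T₂₃⇒Distant (inj₁ t₂))) ∷ []
    ΠPath⇒chordless (via-S₁S₂ _ s₂ x∈ _ _) =
      ¬RW₁⇒nonadj (proj₂ (S₂⇒Distant s₂)) ∷ ¬RW₁⇒nonadj (proj₂ (T₂₃⇒Distant x∈)) ∷ []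

    firstVertex : RootedPath G L → Fin n
    firstVertex ([] , x)    = x
    firstVertex (s ∷ _ , _) = s

    ΠPath-first-RW₁ : ∀ {p} → ΠPath p → RW₁ (firstVertex p)
    ΠPath-first-RW₁ (direct ((_ , rw , _) , _))           = rw
    ΠPath-first-RW₁ (via-S₁ ((_ , rw , _) , _) _ _)       = rw
    ΠPath-first-RW₁ (via-S₁S₂ ((_ , rw , _) , _) _ _ _ _) = rw

    OnArc : Fin n → Fin n → RootedPath G L → Set
    OnArc a b p = (a , b) ∈ arcs (pathVs G L u p)

    first-arc : ∀ p → OnArc u (firstVertex p) p
    first-arc ([] , _)    = here refl
    first-arc (_ ∷ _ , _) = here refl

    first∈tail : ∀ p → firstVertex p ∈ tailVs G L p
    first∈tail p = arcs-target∈ (first-arc p)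

    admissible⇒unique : ∀ {r p} → Admissible G L r u p → Unique (pathVs G L u p)
    admissible⇒unique ((_ , unique) , _) = unique

    admissible-tail-≢u : ∀ {r p v} → Admissible G L r u p → v ∈ tailVs G L p → v ≢ u
    admissible-tail-≢u ((_ , (u∉ ∷ _)) , _) v∈ refl = All¬⇒¬Any u∉ v∈

    path-∈-tail : ∀ {p v} → v ≢ u → v ∈ pathVs G L u p → v ∈ tailVs G L p
    path-∈-tail v≢u (here v≡u) = contradiction v≡u v≢u
    path-∈-tail _   (there v∈) = v∈

    admissible-through : ∀ {r p v} → Admissible G L r u p → v ∈ tailVs G L p → L v ≡ false →
                         (∃ λ a → OnArc a v p) × (∃ λ b → OnArc v b p)
    admissible-through {p = P , x} (_ , _ , _ , Lx , _) v∈ Lv with ∈-++⁻ P v∈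
    ... | inj₁ v∈P = arcs-pred v∈ , (let b , vb∈ = arcs-succ {P} {x} v∈P in b , arcs-∷ vb∈)
    ... | inj₂ (here refl) = contradiction refl (R≢L Lv Lx)

    flow : List (RootedPath G L) → Fin n → Fin n → ℕ
    flow = flowOf G L u

    flow-∉ : ∀ {H a b} → ¬ Any (OnArc a b) H → flow H a b ≡ 0
    flow-∉ {H} ∉H = sum-map-≡0 _ λ p∈ → countArc-∉ λ on → ∉H (lose p∈ on)

    flow-≢0 : ∀ {H a b} → flow H a b ≢ 0 → Any (OnArc a b) H
    flow-≢0 {H} flow≢0 = let p , p∈ , count≢0 = sum-map-≢0 _ H flow≢0 in lose p∈ (countArc-≢0 count≢0)

    arc-unshared : ∀ {H p a b} → All (DisjointTails p) H → OnArc a b p → ¬ Any (OnArc a b) H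
    arc-unshared dj ab∈p ab∈H =
      let q , q∈ , ab∈q = find ab∈H in All.lookup dj q∈ (arcs-target∈ ab∈p , arcs-target∈ ab∈q)

    flow-≡1 : ∀ {r H a b} → Packing G L r u H → Any (OnArc a b) H → flow H a b ≡ 1
    flow-≡1 (ad ∷ _ , dj ∷ _) (here ab∈p) =
      cong₂ _+_ (countArc-∈ (arcs-unique (admissible⇒unique ad)) ab∈p) (flow-∉ (arc-unshared dj ab∈p))
    flow-≡1 (_ ∷ ads , dj ∷ djs) (there ab∈H) =
      cong₂ _+_ (countArc-∉ λ ab∈p → arc-unshared dj ab∈p ab∈H) (flow-≡1 (ads , djs) ab∈H)

    flow-≤1 : ∀ {r H a b} → Packing G L r u H → flow H a b ≤ 1
    flow-≤1 {H = H} {a} {b} pk with flow H a b ℕ.≟ 0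
    ... | yes flow≡0 = subst (_≤ 1) (sym flow≡0) z≤n
    ... | no  flow≢0 = ℕ.≤-reflexive (flow-≡1 pk (flow-≢0 flow≢0))

    arc-on-path : ∀ {r K q a b} → Packing G L r u K → q ∈ K → Any (OnArc a b) K →
                  a ∈ tailVs G L q → OnArc a b q
    arc-on-path (ads , djs) q∈ ab∈K a∈q =
      let q′ , q′∈ , ab∈q′ = find ab∈K
          a≢u = admissible-tail-≢u (All.lookup ads q∈) a∈q
      in subst (OnArc _ _) (tails-meet⇒≡ djs q′∈ q∈ (path-∈-tail a≢u (arcs-source∈ ab∈q′)) a∈q) ab∈q′

    flow-pred-unique : ∀ {r H a a′ v} → Packing G L r u H →
                       flow H a v ≢ 0 → flow H a′ v ≢ 0 → a ≡ a′
    flow-pred-unique (ads , djs) ≢0 ≢0′ =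
      let p , p∈ , av∈p = find (flow-≢0 ≢0)
          q , q∈ , a′v∈q = find (flow-≢0 ≢0′)
      in arcs-pred-unique (admissible⇒unique (All.lookup ads p∈)) av∈p
           (subst (OnArc _ _) (tails-meet⇒≡ djs q∈ p∈ (arcs-target∈ a′v∈q) (arcs-target∈ av∈p)) a′v∈q)

    flow-succ-unique : ∀ {r H v b b′} → Packing G L r u H → v ≢ u →
                       flow H v b ≢ 0 → flow H v b′ ≢ 0 → b ≡ b′
    flow-succ-unique pk@(ads , _) v≢u ≢0 ≢0′ =
      let p , p∈ , vb∈p = find (flow-≢0 ≢0)
      in arcs-succ-unique (admissible⇒unique (All.lookup ads p∈)) vb∈p
           (arc-on-path pk p∈ (flow-≢0 ≢0′) (path-∈-tail v≢u (arcs-source∈ vb∈p)))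

    inflow-≤1 : ∀ {r H v} → Packing G L r u H → inflow G L u (flow H) v ≤ 1
    inflow-≤1 pk = total-≤1 (λ _ → flow-≤1 pk) (λ _ _ → flow-pred-unique pk)

    outflow-≤1 : ∀ {r H v} → Packing G L r u H → v ≢ u → outflow G L u (flow H) v ≤ 1
    outflow-≤1 pk v≢u = total-≤1 (λ _ → flow-≤1 pk) (λ _ _ → flow-succ-unique pk v≢u)

    flow-conserved : ∀ {r H v} → Packing G L r u H → L v ≡ false → v ≢ u →
                     inflow G L u (flow H) v ≡ outflow G L u (flow H) v
    flow-conserved {H = H} {v} pk@(ads , _) Lv v≢u with Any.any? (λ p → v ∈? tailVs G L p) H
    ... | no v∉H =
      trans (total-≡0 {g = λ a → flow H a v} λ _ → flow-∉ (v∉H ∘ Any.map arcs-target∈))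
            (sym (total-≡0 {g = flow H v} λ _ →
                    flow-∉ (v∉H ∘ Any.map (path-∈-tail v≢u ∘ arcs-source∈))))
    ... | yes v∈H =
      let p , p∈ , v∈p = find v∈H
          (a , av∈p) , (b , vb∈p) = admissible-through (All.lookup ads p∈) v∈p Lv
          av≡1 = flow-≡1 pk (lose p∈ av∈p)
          vb≡1 = flow-≡1 pk (lose p∈ vb∈p)
      in begin
        inflow G L u (flow H) v
          ≡⟨ total-≡ {g = λ a → flow H a v} (λ _ ≢0 → flow-pred-unique pk ≢0 (≡1⇒≢0 av≡1)) ⟩
        flow H a v
          ≡⟨ trans av≡1 (sym vb≡1) ⟩
        flow H v b
          ≡⟨ total-≡ {g = flow H v} (λ _ ≢0 → flow-succ-unique pk v≢u ≢0 (≡1⇒≢0 vb≡1)) ⟨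
        outflow G L u (flow H) v
          ∎
      where open ≡-Reasoning

    packing-flow-integral : ∀ {H} → ChordlessPacking G L 3 u H → IntegralFlow G L u (flow H)
    packing-flow-integral {H} ((pk@(ads , _)) , chordless) =
        (λ _ _ 0<flow →
           let p , p∈ , ab∈p = find (flow-≢0 (ℕ.n>0⇒n≢0 0<flow))
               π = chordless⇒ΠPath (All.lookup ads p∈) (All.lookup chordless p∈)
           in All.lookup (ΠPath-arcs π) ab∈p)
      , (λ _ _ → flow-≤1 pk)
      , (λ _ _ → inflow-≤1 pk)
      , (λ _ → outflow-≤1 pk)
      , (λ _ → [ conserved , conserved ])
      where
      conserved : ∀ {i v} → S G L u i v → inflow G L u (flow H) v ≡ outflow G L u (flow H) v
      conserved s = flow-conserved pk (S-R s) (S-≢u s)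

    packing-unique : ∀ {r H} → Packing G L r u H → Unique H
    packing-unique (_ , djs) = AllPairs.map DisjointTails⇒≢ djs

    flow-transfer : ∀ {r H H′ a b} → Packing G L r u H → (∀ a b → flow H a b ≡ flow H′ a b) →
                    Any (OnArc a b) H → Any (OnArc a b) H′
    flow-transfer {a = a} {b} pk same ab∈H =
      flow-≢0 (≡1⇒≢0 (trans (sym (same a b)) (flow-≡1 pk ab∈H)))

    flow-arcs-follow : ∀ {r r′ H H′ p q c} → Packing G L r u H → Packing G L r′ u H′ →
                       (∀ a b → flow H a b ≡ flow H′ a b) → p ∈ H → q ∈ H′ →
                       OnArc u c p → OnArc u c q → ArcsFollow (pathVs G L u p) (pathVs G L u q)
    flow-arcs-follow pk pk′ same p∈ q∈ uc∈p uc∈q ab∈p (here refl)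
      with arcs-succ-unique (admissible⇒unique (All.lookup (proj₁ pk) p∈)) uc∈p ab∈p
    ... | refl = uc∈q
    flow-arcs-follow pk pk′ same p∈ q∈ _ _ ab∈p (there a∈q) =
      arc-on-path pk′ q∈ (flow-transfer pk same (lose p∈ ab∈p)) a∈q

    flow-⊆ : ∀ {r r′ H H′} → Packing G L r u H → Packing G L r′ u H′ →
             (∀ a b → flow H a b ≡ flow H′ a b) → ∀ {p} → p ∈ H → p ∈ H′
    flow-⊆ pk pk′ same {p} p∈ =
      let q , q∈ , uc∈q = find (flow-transfer pk same (lose p∈ (first-arc p)))
          same′ = λ a b → sym (same a b)
          tails≡ = arcs-agree⇒≡ (admissible⇒unique (All.lookup (proj₁ pk) p∈))
                                (admissible⇒unique (All.lookup (proj₁ pk′) q∈))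
                                (flow-arcs-follow pk pk′ same p∈ q∈ (first-arc p) uc∈q)
                                (flow-arcs-follow pk′ pk same′ q∈ p∈ uc∈q (first-arc p))
      in subst (_∈ _) (sym (tailVs-injective tails≡)) q∈

    flow-injective : ∀ {r r′ H H′} → Packing G L r u H → Packing G L r′ u H′ →
                     (∀ a b → flow H a b ≡ flow H′ a b) → H ↭ H′
    flow-injective pk pk′ same = ∼bag⇒↭ (unique∧set⇒bag (packing-unique pk) (packing-unique pk′)
      (mk⇔ (flow-⊆ pk pk′ same) (flow-⊆ pk′ pk λ a b → sym (same a b))))

    module _ {f : Fin n → Fin n → ℕ} (φ : IntegralFlow G L u f) where

      flow⇒ΠArc : ∀ {a b} → f a b ≡ 1 → ΠArc a b
      flow⇒ΠArc {a} {b} e = proj₁ φ a b (subst (0 <_) (sym e) (s≤s z≤n))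

      ≢0⇒≡1 : ∀ {a b} → f a b ≢ 0 → f a b ≡ 1
      ≢0⇒≡1 {a} {b} ≢0 = ℕ.≤-antisym (proj₁ (proj₂ φ) a b) (ℕ.n≢0⇒n>0 ≢0)

      pred-unique : ∀ {a a′ z} → z ≢ u → f a z ≡ 1 → f a′ z ≡ 1 → a ≡ a′
      pred-unique {z = z} z≢u = total-≤1⇒≡ (proj₁ (proj₂ (proj₂ φ)) z z≢u)

      succ-unique : ∀ {v b b′} → v ≢ u → f v b ≡ 1 → f v b′ ≡ 1 → b ≡ b′
      succ-unique {v} v≢u = total-≤1⇒≡ (proj₁ (proj₂ (proj₂ (proj₂ φ))) v v≢u)

      flow-onward : ∀ {a v} → S₁ v ⊎ S₂ v → f a v ≡ 1 → ∃ λ b → f v b ≡ 1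
      flow-onward {a} {v} v∈S e =
        let in≢0 = ≢0⇒total≢0 {g = λ a → f a v} {a} (≡1⇒≢0 e)
            b , ≢0 = total-≢0 (subst (_≢ 0) (proj₂ (proj₂ (proj₂ (proj₂ φ))) v v∈S) in≢0)
        in b , ≢0⇒≡1 ≢0

      flow-backward : ∀ {v b} → S₁ v ⊎ S₂ v → f v b ≡ 1 → ∃ λ a → f a v ≡ 1
      flow-backward {v} {b} v∈S e =
        let out≢0 = ≢0⇒total≢0 {g = λ b → f v b} {b} (≡1⇒≢0 e)
            a , ≢0 = total-≢0 (subst (_≢ 0) (sym (proj₂ (proj₂ (proj₂ (proj₂ φ))) v v∈S)) out≢0)
        in a , ≢0⇒≡1 ≢0

      fed-by-u : ∀ {a b} → S₁ a → f a b ≡ 1 → f u a ≡ 1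
      fed-by-u s₁ e = let a₀ , e₀ = flow-backward (inj₁ s₁) e in
        subst (λ a₀ → f a₀ _ ≡ 1) (ΠArc-into-S₁ s₁ (flow⇒ΠArc e₀)) e₀

      FlowPath : RootedPath G L → Set
      FlowPath p = ΠPath p × All (uncurry λ a c → f a c ≡ 1) (arcs (pathVs G L u p))

      FlowPathFrom : Fin n → RootedPath G L → Set
      FlowPathFrom b p = FlowPath p × firstVertex p ≡ b

      flowPath-from : ∀ {b} → f u b ≡ 1 → Σ (RootedPath G L) (FlowPathFrom b)
      flowPath-from {b} e with ΠArc-from-u (flow⇒ΠArc e)
      ... | inj₁ t₁ = ([] , b) , (direct t₁ , e ∷ []) , refl
      ... | inj₂ s₁ with flow-onward (inj₁ s₁) e
      ...   | c , e′ with ΠArc-from-S₁ s₁ (flow⇒ΠArc e′)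
      ...     | inj₂ t₂ = (b ∷ [] , c) , (via-S₁ s₁ t₂ (proj₁ (flow⇒ΠArc e′)) , e ∷ e′ ∷ []) , refl
      ...     | inj₁ s₂ with flow-onward (inj₂ s₂) e′
      ...       | d , e″ =
        (b ∷ c ∷ [] , d) ,
        (via-S₁S₂ s₁ s₂ (ΠArc-from-S₂ s₂ (flow⇒ΠArc e″)) (proj₁ (flow⇒ΠArc e′)) (proj₁ (flow⇒ΠArc e″)) ,
         e ∷ e′ ∷ e″ ∷ []) ,
        refl

      flowPath-covers : ∀ {p a c} → FlowPath p → a ∈ tailVs G L p → L a ≡ false → f a c ≡ 1 →
                        OnArc a c p
      flowPath-covers (π , carried) a∈ La e
        with admissible-through (ΠPath⇒admissible π) a∈ La
      ... | _ , (_ , ay∈)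
        with succ-unique (admissible-tail-≢u (ΠPath⇒admissible π) a∈) (All.lookup carried ay∈) e
      ... | refl = ay∈

      -- Flow predecessors are unique and only a trail's first vertex is adjacent to u, so two
      -- trails ending at the same vertex start at the same vertex.
      data Trail (b : Fin n) : Fin n → Set where
        start : Trail b b
        step  : ∀ {t z} → Trail b t → f t z ≡ 1 → Distant z → Trail b z

      trails-meet : ∀ {b b′ z} → RW₁ b → RW₁ b′ → Trail b z → Trail b′ z → b ≡ b′
      trails-meet _  _   start                start                = refl
      trails-meet rw _   start                (step _ _ (_ , ¬rw)) = contradiction rw ¬rw
      trails-meet _  rw′ (step _ _ (_ , ¬rw)) start                = contradiction rw′ ¬rw
      trails-meet rw rw′ (step τ e (z≢u , _)) (step τ′ e′ _) with pred-unique z≢u e e′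
      ... | refl = trails-meet rw rw′ τ τ′

      flowPath-trail : ∀ {p z} → FlowPath p → z ∈ tailVs G L p → Trail (firstVertex p) z
      flowPath-trail (direct _ , _)                     (here refl)                 = start
      flowPath-trail (direct _ , _)                     (there ())
      flowPath-trail (via-S₁ _ _ _ , _)                 (here refl)                 = start
      flowPath-trail (via-S₁ _ t₂ _ , _ ∷ e ∷ [])       (there (here refl))         =
        step start e (T₂₃⇒Distant (inj₁ t₂))
      flowPath-trail (via-S₁ _ _ _ , _)                 (there (there ()))
      flowPath-trail (via-S₁S₂ _ _ _ _ _ , _)           (here refl)                 = start
      flowPath-trail (via-S₁S₂ _ s₂ _ _ _ , _ ∷ e ∷ _)  (there (here refl))         =
        step start e (S₂⇒Distant s₂)
      flowPath-trail (via-S₁S₂ _ s₂ x∈ _ _ , _ ∷ e ∷ e′ ∷ []) (there (there (here refl))) =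
        step (step start e (S₂⇒Distant s₂)) e′ (T₂₃⇒Distant x∈)
      flowPath-trail (via-S₁S₂ _ _ _ _ _ , _)           (there (there (there ())))

      flowPaths-meet : ∀ {b b′ p p′ z} → FlowPathFrom b p → FlowPathFrom b′ p′ →
                       z ∈ tailVs G L p → z ∈ tailVs G L p′ → b ≡ b′
      flowPaths-meet (fp , refl) (fp′ , refl) z∈ z∈′ =
        trails-meet (ΠPath-first-RW₁ (proj₁ fp)) (ΠPath-first-RW₁ (proj₁ fp′))
                    (flowPath-trail fp z∈) (flowPath-trail fp′ z∈′)

      Routes : List (Fin n) → Set
      Routes = All (λ b → Σ (RootedPath G L) (FlowPathFrom b))

      paths : ∀ {bs} → Routes bs → List (RootedPath G L)
      paths = All.reduce proj₁

      paths-flowPaths : ∀ {bs} (rs : Routes bs) → All FlowPath (paths rs)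
      paths-flowPaths []                   = []
      paths-flowPaths ((_ , fp , _) ∷ rs) = fp ∷ paths-flowPaths rs

      paths-∋ : ∀ {bs b} (rs : Routes bs) → b ∈ bs → ∃ λ p → p ∈ paths rs × FlowPathFrom b p
      paths-∋ ((p , fp) ∷ _)  (here refl) = p , here refl , fp
      paths-∋ (_ ∷ rs)        (there b∈)  = let p , p∈ , fp = paths-∋ rs b∈ in p , there p∈ , fp

      paths-disjoint : ∀ {bs} (rs : Routes bs) → Unique bs → AllPairs DisjointTails (paths rs)
      paths-disjoint []              []          = []
      paths-disjoint ((_ , fp) ∷ rs) (b∉ ∷ bs!) = apart rs b∉ ∷ paths-disjoint rs bs!
        where
        apart : ∀ {cs} (rs : Routes cs) → All (_ ≢_) cs → All (DisjointTails _) (paths rs)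
        apart []               []           = []
        apart ((_ , fp′) ∷ rs) (b≢c ∷ b≢cs) =
          (λ (z∈ , z∈′) → b≢c (flowPaths-meet fp fp′ z∈ z∈′)) ∷ apart rs b≢cs

      fed? : ∀ b → Dec (f u b ≡ 1)
      fed? b = f u b ℕ.≟ 1

      routes : Routes (filter fed? (allFin n))
      routes = All.map flowPath-from (all-filter fed? (allFin n))

      decomposition : List (RootedPath G L)
      decomposition = paths routes

      decomposition-flowPaths : All FlowPath decomposition
      decomposition-flowPaths = paths-flowPaths routes

      decomposition-packing : ChordlessPacking G L 3 u decomposition
      decomposition-packing =
        ( All.map (ΠPath⇒admissible ∘ proj₁) decomposition-flowPaths
        , paths-disjoint routes (Unique.filter⁺ fed? (Unique.allFin⁺ n)) )
        , All.map (ΠPath⇒chordless ∘ proj₁) decomposition-flowPaths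

      route-through : ∀ {a c b} → f u b ≡ 1 → (∀ {p} → FlowPathFrom b p → OnArc a c p) →
                      Any (OnArc a c) decomposition
      route-through {b = b} e on =
        let p , p∈ , fp = paths-∋ routes (∈-filter⁺ fed? (∈-allFin b) e) in lose p∈ (on fp)

      decomposition-covers : ∀ {a c} → f a c ≡ 1 → Any (OnArc a c) decomposition
      decomposition-covers e with ΠArc-source (flow⇒ΠArc e)
      ... | inj₁ refl = route-through e λ { (_ , refl) → first-arc _ }
      ... | inj₂ (inj₁ s₁) =
        route-through (fed-by-u s₁ e) λ { (fp , refl) → flowPath-covers fp (first∈tail _) (S-R s₁) e }
      ... | inj₂ (inj₂ s₂) with flow-backward (inj₂ s₂) e
      ...   | _ , e₁ =
        let s₁ = ΠArc-into-S₂ s₂ (flow⇒ΠArc e₁)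
        in route-through (fed-by-u s₁ e₁) λ { (fp , refl) →
             let a∈p = arcs-target∈ (flowPath-covers fp (first∈tail _) (S-R s₁) e₁)
             in flowPath-covers fp a∈p (S-R s₂) e }

      decomposition-carries : ∀ {a c} → Any (OnArc a c) decomposition → f a c ≡ 1
      decomposition-carries ac∈ =
        let p , p∈ , ac∈p = find ac∈ in All.lookup (proj₂ (All.lookup decomposition-flowPaths p∈)) ac∈p

      decomposition-flow : ∀ a c → flow decomposition a c ≡ f a c
      decomposition-flow a c with f a c ℕ.≟ 0
      ... | yes fac≡0 =
        trans (flow-∉ λ ac∈ → ≡1⇒≢0 (decomposition-carries ac∈) fac≡0) (sym fac≡0)
      ... | no fac≢0 =
        let fac≡1 = ≢0⇒≡1 fac≢0
        in trans (flow-≡1 (proj₁ decomposition-packing) (decomposition-covers fac≡1)) (sym fac≡1)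

    flow-decomposes : ∀ {f} → IntegralFlow G L u f →
      Σ (List (RootedPath G L)) λ H → ChordlessPacking G L 3 u H × (∀ a b → flow H a b ≡ f a b)
    flow-decomposes φ = decomposition φ , decomposition-packing φ , decomposition-flow φ

lemma4 : (n : ℕ) (G : Graph n) (L : Fin n → Bool) (u : Fin n) → L u ≡ true →
    ((H : List (RootedPath G L)) → ChordlessPacking G L 3 u H →
    IntegralFlow G L u (flowOf G L u H))
    × ((H H′ : List (RootedPath G L)) → ChordlessPacking G L 3 u H →
    ChordlessPacking G L 3 u H′ →
    (∀ a b → flowOf G L u H a b ≡ flowOf G L u H′ a b) → H ↭ H′)
    × ((f : Fin n → Fin n → ℕ) → IntegralFlow G L u f →
    Σ (List (RootedPath G L)) λ H → ChordlessPacking G L 3 u H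
    × (∀ a b → flowOf G L u H a b ≡ f a b))
lemma4 n G L u _ =
    (λ _ → packing-flow-integral G L u)
  , (λ _ _ pk pk′ → flow-injective G L u (proj₁ pk) (proj₁ pk′))
  , (λ _ → flow-decomposes G L u)
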